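{- Let $(P,\le)$ be a modular lattice with bottom element $\bot$, and let $Q$ be the set of quasi-atoms of $P$. Then: (1) There is a finitary pregeometry on $Q$ characterized by the property that a finite set $\{a_1,\ldots,a_n\}$ of quasi-atoms is independent with respect to the pregeometry if and only if (listed in some order) it is an independent sequence in the lattice sense. (2) For every $x\in P$, the set $V(x)=\{a\in Q ~|~ a\wedge x>\bot\}$ is a closed subset of $Q$ for this pregeometry. (3) Two quasi-atoms $a,b$ are parallel (i.e., have the same closure) if and only if $a\wedge b>\bot$. Consequently there is an induced geometry on the equivalence classes of quasi-atoms under the relation $a\wedge b>\bot$.
   Context: An element $a>\bot$ is a quasi-atom if whenever $\bot<x\le a$ and $\bot<y\le a$ we have $x\wedge y>\bot$. A finite sequence $a_1,\ldots,a_n$ of elements of $P$ is independent (in the lattice sense) if $a_k\wedge(a_1\vee\cdots\vee a_{k-1})=\bot$ for $2\le k\le n$. -}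

module Defs where

open import Level using (Level; _⊔_; Lift; lift) renaming (suc to lsuc)
open import Data.Product using (Σ; ∃; ∃-syntax; _×_; _,_)
open import Data.Sum using (_⊎_)
open import Data.List using (List; []; _∷_; length; lookup; take)
open import Data.List.Membership.Propositional using (_∈_)
open import Data.List.Relation.Unary.All using (All)
open import Data.Fin using (Fin; toℕ)
open import Relation.Nullary using (¬_)
open import Relation.Unary using (Pred; _⊆_; _∪_)
open import Relation.Binary using (Rel)
open import Relation.Binary.PropositionalEquality using (_≡_; _≢_)
open import Relation.Binary.Lattice.Structures using (IsLattice)
open import Relation.Binary.Definitions using (Minimum)

record ModularLatticeWithBottom (c ℓ : Level) : Set (lsuc (c ⊔ ℓ)) where
  infixr 7 _∧_
  infixr 6 _∨_
  infix  4 _≤_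
  field
    Carrier   : Set c
    _≤_       : Rel Carrier ℓ
    _∨_       : Carrier → Carrier → Carrier
    _∧_       : Carrier → Carrier → Carrier
    ⊥         : Carrier
    isLattice : IsLattice _≡_ _≤_ _∨_ _∧_
    minimum   : Minimum _≤_ ⊥
    modular   : ∀ x y z → x ≤ z → x ∨ (y ∧ z) ≡ (x ∨ y) ∧ z

  _<_ : Carrier → Carrier → Set (c ⊔ ℓ)
  x < y = x ≤ y × x ≢ y

  IsQuasiAtom : Carrier → Set (c ⊔ ℓ)
  IsQuasiAtom a = (⊥ < a) ×
    (∀ x y → ⊥ < x → x ≤ a → ⊥ < y → y ≤ a → ⊥ < (x ∧ y))

  ⋁ : List Carrier → Carrier
  ⋁ []       = ⊥
  ⋁ (x ∷ xs) = x ∨ ⋁ xs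

  LatticeIndependent : List Carrier → Set c
  LatticeIndependent xs =
    (i : Fin (length xs)) → lookup xs i ∧ ⋁ (take (toℕ i) xs) ≡ ⊥

module _ {a : Level} {X : Set a} (ℓ : Level) where

  listSet : List X → Pred X (a ⊔ ℓ)
  listSet xs x = Lift (a ⊔ ℓ) (x ∈ xs)

  sing : X → Pred X (a ⊔ ℓ)
  sing y x = Lift (a ⊔ ℓ) (x ≡ y)

  minus : Pred X (a ⊔ ℓ) → X → Pred X (a ⊔ ℓ)
  minus A y x = A x × x ≢ y

-- A finitary pregeometry on the subset Q ⊆ X.  Subsets of Q are
-- represented as predicates on X contained in Q; the closure operator is
-- only constrained on such predicates.
record IsFinitaryPregeometry {a q : Level} {X : Set a} (Q : Pred X q)
       (cl : Pred X (a ⊔ q) → Pred X (a ⊔ q)) : Set (lsuc (a ⊔ q)) where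
  field
    closure-in-Q : ∀ A → A ⊆ Q → cl A ⊆ Q
    extensive    : ∀ A → A ⊆ Q → A ⊆ cl A
    monotone     : ∀ A B → A ⊆ B → B ⊆ Q → cl A ⊆ cl B
    idempotent   : ∀ A → A ⊆ Q → cl (cl A) ⊆ cl A
    finitary     : ∀ A → A ⊆ Q → ∀ {x} → cl A x →
                   ∃[ xs ] (All A xs × cl (listSet q xs) x)
    exchange     : ∀ A → A ⊆ Q → ∀ x y → Q x → Q y →
                   cl (A ∪ sing q y) x → ¬ cl A x → cl (A ∪ sing q x) y

module _ {a q : Level} {X : Set a} (cl : Pred X (a ⊔ q) → Pred X (a ⊔ q)) where

  IndependentSet : Pred X (a ⊔ q) → Set (a ⊔ q)
  IndependentSet A = ∀ x → A x → ¬ cl (minus q A x) x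

  Closed : Pred X (a ⊔ q) → Set (a ⊔ q)
  Closed A = cl A ⊆ A

open import Data.List.Relation.Unary.Unique.Propositional using (Unique)
open import Data.List.Relation.Binary.Permutation.Propositional using (_↭_)
open import Function.Bundles using (_⇔_)
import Data.Empty as E

module _ {c ℓ : Level} (L : ModularLatticeWithBottom c ℓ) where
  open ModularLatticeWithBottom L

  -- property (1): a finite set {a₁,…,aₙ} of quasi-atoms (a duplicate-free
  -- list) is independent for cl iff some ordering of it is an
  -- independent sequence in the lattice sense.
  IndependenceCharacterization :
    (Pred Carrier (c ⊔ ℓ) → Pred Carrier (c ⊔ ℓ)) → Set (c ⊔ ℓ)
  IndependenceCharacterization cl =
    ∀ (xs : List Carrier) → All IsQuasiAtom xs → Unique xs →
      (IndependentSet {q = ℓ} cl (listSet ℓ xs)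
        ⇔ (∃[ ys ] (ys ↭ xs × LatticeIndependent ys)))

  V : Carrier → Pred Carrier (c ⊔ ℓ)
  V x a = IsQuasiAtom a × (⊥ < (a ∧ x))

  emptySet : Pred Carrier (c ⊔ ℓ)
  emptySet _ = Lift (c ⊔ ℓ) E.⊥

-- Write "x meets y" for ⊥ < x ∧ y. The key modular fact is that if d₁, …, dₙ are independent
-- quasi-atoms all meeting y, then ⋁ (dᵢ ∧ y) is essential in ⋁ dᵢ, so whatever meets ⋁ dᵢ
-- meets y. Taking as closure of A the quasi-atoms that meet every y met by all elements of
-- some finite part of A, a quasi-atom therefore lies in the closure of an independent list
-- exactly when it meets its join; exchange and the characterization of independence follow
-- from this and modularity, and each V(y) is closed by construction. Conversely, in any
-- pregeometry with that characterization, x lies in the closure of A iff x meets the join of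
-- an independent list from A (excluded middle extracts maximal independent sublists), so such
-- a pregeometry is unique. Finally closure {a} = Q ∩ V(a), which gives the parallelism criterion.

module Submission where

open import Defs
open import Level using (Level; _⊔_; Lift; lift)
open import Function using (_∘_)
open import Data.Product using (Σ; _×_; _,_; proj₁; proj₂; ∃-syntax)
open import Data.Empty using (⊥-elim)
open import Data.Sum using (_⊎_; inj₁; inj₂)
open import Data.Unit.Polymorphic using (⊤)
open import Data.List using (List; []; _∷_; map; _++_; lookup; take)
open import Data.List.Relation.Unary.All as All using (All; []; _∷_)
open import Data.List.Relation.Unary.All.Properties
  using (¬Any⇒All¬; All¬⇒¬Any; ++⁺; ++⁻ˡ; ++⁻ʳ)
open import Data.List.Relation.Unary.Any using (here; there)
open import Data.List.Relation.Unary.AllPairs as AllPairs using ([]; _∷_)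
open import Data.List.Relation.Unary.Unique.Propositional using (Unique)
open import Data.List.Membership.Propositional using (_∈_; _∉_)
open import Data.List.Membership.Propositional.Properties using (∈-∃++)
open import Data.List.Relation.Binary.Permutation.Propositional
  using (_↭_; refl; prep; swap; trans)
open import Data.List.Relation.Binary.Permutation.Propositional.Properties using (shift; ∈-resp-↭)
open import Data.List.Relation.Binary.Subset.Propositional.Properties using (∷⁺ʳ; xs⊆x∷xs)
open import Data.Fin using (zero; suc; toℕ)
open import Relation.Nullary using (¬_; yes; no)
open import Relation.Unary using (Pred; _⊆_; _≐_; _∪_)
open import Relation.Binary.PropositionalEquality
  using (_≡_; _≢_; refl; sym; cong; subst; subst₂; module ≡-Reasoning) renaming (trans to ≡-trans)
open import Relation.Binary.Lattice using (Lattice; BoundedJoinSemilattice)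
import Relation.Binary.Lattice.Properties.JoinSemilattice as JoinSemilatticeProperties
import Relation.Binary.Lattice.Properties.MeetSemilattice as MeetSemilatticeProperties
import Relation.Binary.Lattice.Properties.BoundedJoinSemilattice as BoundedJoinSemilatticeProperties
import Relation.Binary.Reasoning.PartialOrder as ≤-Reasoning
open import Axiom.ExcludedMiddle using (ExcludedMiddle)
open import Function.Bundles using (_⇔_; mk⇔; Equivalence)
open import Function.Properties.Equivalence using () renaming (sym to ⇔-sym; trans to ⇔-trans)

listSet⊆minus-∷ : ∀ {a} {X : Set a} q {x : X} {xs} → x ∉ xs →
                  listSet q xs ⊆ minus q (listSet q (x ∷ xs)) x
listSet⊆minus-∷ q {xs = xs} x∉xs (lift y∈xs) =
  lift (there y∈xs) , λ y≡x → x∉xs (subst (_∈ xs) y≡x y∈xs)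

module PregeometryFacts {a q} {X : Set a} {Q : Pred X q} {cl : Pred X (a ⊔ q) → Pred X (a ⊔ q)}
                        (isPregeometry : IsFinitaryPregeometry Q cl) where
  open IsFinitaryPregeometry isPregeometry

  listSet⊆ : ∀ {xs} → All Q xs → listSet q xs ⊆ Q
  listSet⊆ qxs (lift x∈xs) = All.lookup qxs x∈xs

  independentSet-∷⇒∉cl : ∀ {x xs} → All Q (x ∷ xs) → x ∉ xs →
    IndependentSet {q = q} cl (listSet q (x ∷ xs)) → ¬ cl (listSet q xs) x
  independentSet-∷⇒∉cl qxs x∉xs indset x∈cl = indset _ (lift (here refl))
    (monotone _ _ (listSet⊆minus-∷ q x∉xs) (listSet⊆ qxs ∘ proj₁) x∈cl)

  independentSet-tail : ∀ {x xs} → All Q (x ∷ xs) →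
    IndependentSet {q = q} cl (listSet q (x ∷ xs)) → IndependentSet {q = q} cl (listSet q xs)
  independentSet-tail qxs indset z (lift z∈xs) z∈cl = indset z (lift (there z∈xs))
    (monotone _ _ (λ (lift y∈xs , y≢z) → lift (there y∈xs) , y≢z)
                  (listSet⊆ qxs ∘ proj₁) z∈cl)

  independentSet-∷ : ∀ {x xs} → All Q (x ∷ xs) → IndependentSet {q = q} cl (listSet q xs) →
    ¬ cl (listSet q xs) x → IndependentSet {q = q} cl (listSet q (x ∷ xs))
  independentSet-∷ {x} {xs} (qx ∷ qxs) _ x∉cl _ (lift (here refl)) x∈cl =
    x∉cl (monotone _ _ x∷xs∖x⊆xs (listSet⊆ qxs) x∈cl)
    where
    x∷xs∖x⊆xs : minus q (listSet q (x ∷ xs)) x ⊆ listSet q xs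
    x∷xs∖x⊆xs (lift (here refl) , x≢x)  = ⊥-elim (x≢x refl)
    x∷xs∖x⊆xs (lift (there y∈xs) , _) = lift y∈xs
  independentSet-∷ {x} {xs} (qx ∷ qxs) indset x∉cl z (lift (there z∈xs)) z∈cl =
    x∉cl (monotone _ _ xs∖z∪z⊆xs (listSet⊆ qxs)
      (exchange xs∖z (listSet⊆ qxs ∘ proj₁) z x (All.lookup qxs z∈xs) qx
        (monotone _ _ x∷xs∖z⊆xs∖z∪x xs∖z∪x⊆Q z∈cl) (indset z (lift z∈xs))))
    where
    xs∖z = minus q (listSet q xs) z
    x∷xs∖z⊆xs∖z∪x : minus q (listSet q (x ∷ xs)) z ⊆ xs∖z ∪ sing q x
    x∷xs∖z⊆xs∖z∪x (lift (here refl) , _)      = inj₂ (lift refl)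
    x∷xs∖z⊆xs∖z∪x (lift (there y∈xs) , y≢z) = inj₁ (lift y∈xs , y≢z)
    xs∖z∪x⊆Q : xs∖z ∪ sing q x ⊆ Q
    xs∖z∪x⊆Q (inj₁ (y∈xs , _))    = listSet⊆ qxs y∈xs
    xs∖z∪x⊆Q (inj₂ (lift refl)) = qx
    xs∖z∪z⊆xs : xs∖z ∪ sing q z ⊆ listSet q xs
    xs∖z∪z⊆xs (inj₁ (y∈xs , _))    = y∈xs
    xs∖z∪z⊆xs (inj₂ (lift refl)) = lift z∈xs

module ModularLatticeFacts {c ℓ} (L : ModularLatticeWithBottom c ℓ) where
  open ModularLatticeWithBottom L

  lattice : Lattice c c ℓ
  lattice = record
    { _≈_ = _≡_ ; _≤_ = _≤_ ; _∨_ = _∨_ ; _∧_ = _∧_ ; isLattice = isLattice }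

  open Lattice lattice public
    using (x≤x∨y; y≤x∨y; ∨-least; x∧y≤x; x∧y≤y; ∧-greatest; antisym; reflexive; poset)
    renaming (refl to ≤-refl; trans to ≤-trans)
  open JoinSemilatticeProperties (Lattice.joinSemilattice lattice) public
    using (∨-comm; ∨-assoc; ∨-monotonic)
  open MeetSemilatticeProperties (Lattice.meetSemilattice lattice) public
    using (∧-comm)

  boundedJoinSemilattice : BoundedJoinSemilattice c c ℓ
  boundedJoinSemilattice = record
    { isBoundedJoinSemilattice = record
      { isJoinSemilattice = Lattice.isJoinSemilattice lattice ; minimum = minimum } }

  open BoundedJoinSemilatticeProperties boundedJoinSemilattice public
    using (identityˡ; identityʳ)

  ≤⊥⇒≡⊥ : ∀ {x} → x ≤ ⊥ → x ≡ ⊥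
  ≤⊥⇒≡⊥ {x} x≤⊥ = antisym x≤⊥ (minimum x)

  ≢⊥⇒⊥< : ∀ {x} → x ≢ ⊥ → ⊥ < x
  ≢⊥⇒⊥< {x} x≢⊥ = minimum x , x≢⊥ ∘ sym

  ⊥<⇒≢⊥ : ∀ {x} → ⊥ < x → x ≢ ⊥
  ⊥<⇒≢⊥ (_ , ⊥≢x) = ⊥≢x ∘ sym

  ⊥<-mono : ∀ {x y} → ⊥ < x → x ≤ y → ⊥ < y
  ⊥<-mono ⊥<x x≤y =
    ≢⊥⇒⊥< λ y≡⊥ → ⊥<⇒≢⊥ ⊥<x (≤⊥⇒≡⊥ (≤-trans x≤y (reflexive y≡⊥)))

  Disjoint : Carrier → Carrier → Set c
  Disjoint x y = x ∧ y ≡ ⊥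

  infix 4 _meets_
  _meets_ : Carrier → Carrier → Set (c ⊔ ℓ)
  x meets y = ⊥ < (x ∧ y)

  below-disjoint : ∀ {x y w} → Disjoint x y → w ≤ x → w ≤ y → w ≡ ⊥
  below-disjoint x⊥y w≤x w≤y = ≤⊥⇒≡⊥ (≤-trans (∧-greatest w≤x w≤y) (reflexive x⊥y))

  disjoint-anti : ∀ {x y x′ y′} → Disjoint x y → x′ ≤ x → y′ ≤ y → Disjoint x′ y′
  disjoint-anti {x′ = x′} {y′} x⊥y x′≤x y′≤y =
    below-disjoint x⊥y (≤-trans (x∧y≤x x′ y′) x′≤x) (≤-trans (x∧y≤y x′ y′) y′≤y)

  disjoint-sym : ∀ {x y} → Disjoint x y → Disjoint y x
  disjoint-sym {x} {y} x⊥y = below-disjoint x⊥y (x∧y≤y y x) (x∧y≤x y x)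

  meets-mono : ∀ {x y x′ y′} → x meets y → x ≤ x′ → y ≤ y′ → x′ meets y′
  meets-mono {x} {y} x-meets-y x≤x′ y≤y′ = ⊥<-mono x-meets-y (∧-greatest
    (≤-trans (x∧y≤x x y) x≤x′) (≤-trans (x∧y≤y x y) y≤y′))

  meets-sym : ∀ {x y} → x meets y → y meets x
  meets-sym {x} {y} x-meets-y = ⊥<-mono x-meets-y (reflexive (∧-comm x y))

  ⊥<⇒meets-above : ∀ {x y} → ⊥ < x → x ≤ y → x meets y
  ⊥<⇒meets-above ⊥<x x≤y = ⊥<-mono ⊥<x (∧-greatest ≤-refl x≤y)

  meets-via-quasiAtom : ∀ {x a y} → IsQuasiAtom a → x meets a → a meets y → x meets y
  meets-via-quasiAtom {x} {a} {y} (_ , qa) x-meets-a a-meets-y = meets-mono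
    (qa (a ∧ x) (a ∧ y) (meets-sym x-meets-a) (x∧y≤x a x) a-meets-y (x∧y≤x a y))
    (x∧y≤y a x) (x∧y≤y a y)

  modular-cancel : ∀ {x y z w} → Disjoint x (y ∨ z) → w ≤ y ∨ x → w ≤ y ∨ z → w ≤ y
  modular-cancel {x} {y} {z} {w} x⊥y∨z w≤y∨x w≤y∨z = begin
    w                  ≤⟨ ∧-greatest w≤y∨x w≤y∨z ⟩
    (y ∨ x) ∧ (y ∨ z)  ≡⟨ modular y x (y ∨ z) (x≤x∨y y z) ⟨
    y ∨ (x ∧ (y ∨ z))  ≡⟨ cong (y ∨_) x⊥y∨z ⟩
    y ∨ ⊥              ≡⟨ identityʳ y ⟩
    y                  ∎
    where open ≤-Reasoning poset

  disjoint-regroupʳ : ∀ {x y z} → Disjoint x (y ∨ z) → Disjoint y z →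
                      Disjoint (x ∨ y) z × Disjoint x y
  disjoint-regroupʳ {x} {y} {z} x⊥y∨z y⊥z =
    below-disjoint y⊥z
      (modular-cancel x⊥y∨z (≤-trans (x∧y≤x (x ∨ y) z) (reflexive (∨-comm x y)))
                            (≤-trans (x∧y≤y (x ∨ y) z) (y≤x∨y y z)))
      (x∧y≤y (x ∨ y) z) ,
    disjoint-anti x⊥y∨z ≤-refl (x≤x∨y y z)

  disjoint-regroupˡ : ∀ {x y z} → Disjoint (x ∨ y) z → Disjoint x y →
                      Disjoint x (y ∨ z) × Disjoint y z
  disjoint-regroupˡ {x} {y} {z} x∨y⊥z x⊥y =
    below-disjoint x⊥y
      (x∧y≤x x (y ∨ z))
      (modular-cancel (disjoint-anti (disjoint-sym x∨y⊥z) ≤-refl (reflexive (∨-comm y x)))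
                      (x∧y≤y x (y ∨ z)) (≤-trans (x∧y≤x x (y ∨ z)) (y≤x∨y y x))) ,
    disjoint-anti x∨y⊥z (y≤x∨y x y) ≤-refl

  disjoint-swap : ∀ {x y z} → Disjoint x (y ∨ z) → Disjoint y z →
                  Disjoint y (x ∨ z) × Disjoint x z
  disjoint-swap {x} {y} {z} x⊥y∨z y⊥z =
    let x∨y⊥z , x⊥y = disjoint-regroupʳ x⊥y∨z y⊥z
    in disjoint-regroupˡ (subst (λ t → Disjoint t z) (∨-comm x y) x∨y⊥z) (disjoint-sym x⊥y)

  meets-exchange : ∀ {x u a} → Disjoint x u → x meets u ∨ a → a meets u ∨ x
  meets-exchange {x} {u} {a} x⊥u x-meets = ≢⊥⇒⊥< λ a⊥u∨x →
    ⊥<⇒≢⊥ x-meets (below-disjoint x⊥u (x∧y≤x x (u ∨ a))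
      (modular-cancel (disjoint-anti a⊥u∨x ≤-refl (∨-monotonic ≤-refl (x∧y≤x x (u ∨ a))))
                      (x∧y≤y x (u ∨ a)) (y≤x∨y u (x ∧ (u ∨ a)))))

  EssentialIn : Carrier → Carrier → Set (c ⊔ ℓ)
  EssentialIn s t = s ≤ t × (∀ p → ⊥ < p → p ≤ t → p meets s)

  essentialIn-trans : ∀ {s m t} → EssentialIn s m → EssentialIn m t → EssentialIn s t
  essentialIn-trans {m = m} (s≤m , ess₁) (m≤t , ess₂) = ≤-trans s≤m m≤t , λ p ⊥<p p≤t →
    meets-mono (ess₁ (p ∧ m) (ess₂ p ⊥<p p≤t) (x∧y≤y p m)) (x∧y≤x p m) ≤-refl

  essentialIn-∨ʳ : ∀ {s t u} → Disjoint t u → EssentialIn s t → EssentialIn (s ∨ u) (t ∨ u)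
  essentialIn-∨ʳ {s} {t} {u} t⊥u (s≤t , ess) = ∨-monotonic s≤t ≤-refl , meets-s∨u
    where
    -- q = t ∧ (u ∨ p) is nonzero (else p ≤ u) and lies in t, so it meets s; yet q ∧ s ≤ t ∧ u.
    meets-s∨u : ∀ p → ⊥ < p → p ≤ t ∨ u → p meets s ∨ u
    meets-s∨u p ⊥<p p≤t∨u =
      ≢⊥⇒⊥< λ p⊥s∨u → ⊥<⇒≢⊥ (q-meets-s p⊥s∨u) (q∧s≡⊥ p⊥s∨u)
      where
      q = t ∧ (u ∨ p)
      p≤u : Disjoint t (u ∨ p) → p ≤ u
      p≤u t⊥u∨p =
        modular-cancel t⊥u∨p (≤-trans p≤t∨u (reflexive (∨-comm t u))) (y≤x∨y u p)
      q-meets-s : Disjoint p (s ∨ u) → q meets s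
      q-meets-s p⊥s∨u = ess q
        (≢⊥⇒⊥< λ q≡⊥ → ⊥<⇒≢⊥ ⊥<p
          (below-disjoint p⊥s∨u ≤-refl (≤-trans (p≤u q≡⊥) (y≤x∨y s u))))
        (x∧y≤x t (u ∨ p))
      q∧s≡⊥ : Disjoint p (s ∨ u) → q ∧ s ≡ ⊥
      q∧s≡⊥ p⊥s∨u = below-disjoint t⊥u
        (≤-trans (x∧y≤x q s) (x∧y≤x t (u ∨ p)))
        (modular-cancel (disjoint-anti p⊥s∨u ≤-refl (reflexive (∨-comm u s)))
                        (≤-trans (x∧y≤x q s) (x∧y≤y t (u ∨ p)))
                        (≤-trans (x∧y≤y q s) (y≤x∨y u s)))

  essentialIn-∨ : ∀ {s t r u} → Disjoint t u → EssentialIn s t → EssentialIn r u →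
                  EssentialIn (s ∨ r) (t ∨ u)
  essentialIn-∨ {s} {t} {r} {u} t⊥u s⊴t r⊴u = essentialIn-trans
    (subst₂ EssentialIn (∨-comm r s) (∨-comm u s) (essentialIn-∨ʳ u⊥s r⊴u))
    (essentialIn-∨ʳ t⊥u s⊴t)
    where
    u⊥s : Disjoint u s
    u⊥s = disjoint-anti (disjoint-sym t⊥u) ≤-refl (proj₁ s⊴t)

  quasiAtom-essentialIn : ∀ {a y} → IsQuasiAtom a → a meets y → EssentialIn (a ∧ y) a
  quasiAtom-essentialIn {a} {y} (_ , qa) a-meets-y =
    x∧y≤x a y , λ p ⊥<p p≤a → qa p (a ∧ y) ⊥<p p≤a a-meets-y (x∧y≤x a y)

  ∈⇒≤⋁ : ∀ {x xs} → x ∈ xs → x ≤ ⋁ xs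
  ∈⇒≤⋁ {x} {_ ∷ ys} (here refl) = x≤x∨y x (⋁ ys)
  ∈⇒≤⋁ {x} {y ∷ ys} (there x∈ys) = ≤-trans (∈⇒≤⋁ x∈ys) (y≤x∨y y (⋁ ys))

  ⊥<⇒meets-⋁-above : ∀ {xs w} → All (⊥ <_) xs → ⋁ xs ≤ w → All (_meets w) xs
  ⊥<⇒meets-⋁-above ⊥<xs ⋁xs≤w = All.tabulate λ x∈xs →
    ⊥<⇒meets-above (All.lookup ⊥<xs x∈xs) (≤-trans (∈⇒≤⋁ x∈xs) ⋁xs≤w)

  ⋁-↭ : ∀ {xs ys} → xs ↭ ys → ⋁ xs ≡ ⋁ ys
  ⋁-↭ refl = refl
  ⋁-↭ (prep x xs↭ys) = cong (x ∨_) (⋁-↭ xs↭ys)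
  ⋁-↭ (swap {xs} {ys} x y xs↭ys) = begin
    x ∨ (y ∨ ⋁ xs)  ≡⟨ ∨-assoc x y (⋁ xs) ⟨
    (x ∨ y) ∨ ⋁ xs  ≡⟨ cong (_∨ ⋁ xs) (∨-comm x y) ⟩
    (y ∨ x) ∨ ⋁ xs  ≡⟨ ∨-assoc y x (⋁ xs) ⟩
    y ∨ (x ∨ ⋁ xs)  ≡⟨ cong (λ t → y ∨ (x ∨ t)) (⋁-↭ xs↭ys) ⟩
    y ∨ (x ∨ ⋁ ys)  ∎
    where open ≡-Reasoning
  ⋁-↭ (trans xs↭ys ys↭zs) = ≡-trans (⋁-↭ xs↭ys) (⋁-↭ ys↭zs)

  ∈⇒↭∷ : ∀ {x : Carrier} {xs} → x ∈ xs → ∃[ ys ] (xs ↭ x ∷ ys)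
  ∈⇒↭∷ {x} x∈xs with ∈-∃++ x∈xs
  ... | pre , post , refl = pre ++ post , shift x pre post

  ⋁-map-∧≤ : ∀ y xs → ⋁ (map (_∧ y) xs) ≤ y
  ⋁-map-∧≤ y []       = minimum y
  ⋁-map-∧≤ y (x ∷ xs) = ∨-least (x∧y≤y x y) (⋁-map-∧≤ y xs)

  Independent : List Carrier → Set c
  Independent []       = ⊤
  Independent (x ∷ xs) = Disjoint x (⋁ xs) × Independent xs

  independent-↭ : ∀ {xs ys} → xs ↭ ys → Independent xs → Independent ys
  independent-↭ refl ind = ind
  independent-↭ (prep x xs↭ys) (x⊥xs , ind) =
    subst (Disjoint x) (⋁-↭ xs↭ys) x⊥xs , independent-↭ xs↭ys ind
  independent-↭ (swap x y xs↭ys) (x⊥y∨xs , y⊥xs , ind) =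
    let y⊥x∨xs , x⊥xs = disjoint-swap x⊥y∨xs y⊥xs
    in  subst (λ t → Disjoint y (x ∨ t)) (⋁-↭ xs↭ys) y⊥x∨xs ,
        subst (Disjoint x) (⋁-↭ xs↭ys) x⊥xs ,
        independent-↭ xs↭ys ind
  independent-↭ (trans xs↭ys ys↭zs) = independent-↭ ys↭zs ∘ independent-↭ xs↭ys

  IndependentAfter : Carrier → List Carrier → Set c
  IndependentAfter p []       = ⊤
  IndependentAfter p (x ∷ xs) = Disjoint x p × IndependentAfter (p ∨ x) xs

  independentAfter⇔independent : ∀ p xs → IndependentAfter p xs ⇔ Independent (p ∷ xs)
  independentAfter⇔independent p []       =
    mk⇔ (λ _ → ≤⊥⇒≡⊥ (x∧y≤y p ⊥) , _) (λ _ → _)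
  independentAfter⇔independent p (x ∷ xs) = mk⇔
    (λ (x⊥p , after) →
      let p∨x⊥xs , ind = Equivalence.to (independentAfter⇔independent (p ∨ x) xs) after
          p⊥x∨xs , x⊥xs = disjoint-regroupˡ p∨x⊥xs (disjoint-sym x⊥p)
      in  p⊥x∨xs , x⊥xs , ind)
    (λ (p⊥x∨xs , x⊥xs , ind) →
      let p∨x⊥xs , p⊥x = disjoint-regroupʳ p⊥x∨xs x⊥xs
      in  disjoint-sym p⊥x ,
          Equivalence.from (independentAfter⇔independent (p ∨ x) xs) (p∨x⊥xs , ind))

  independentAfter⇔prefixDisjoint : ∀ p xs →
    IndependentAfter p xs ⇔ (∀ i → Disjoint (lookup xs i) (p ∨ ⋁ (take (toℕ i) xs)))
  independentAfter⇔prefixDisjoint p []       = mk⇔ (λ _ ()) (λ _ → _)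
  independentAfter⇔prefixDisjoint p (x ∷ xs) = mk⇔
    (λ { (x⊥p , _)     zero    → subst (Disjoint x) (sym (identityʳ p)) x⊥p
       ; (_   , after) (suc i) → subst (Disjoint (lookup xs i)) (∨-assoc p x _)
                                   (Equivalence.to rest after i) })
    (λ prefix → subst (Disjoint x) (identityʳ p) (prefix zero) ,
                Equivalence.from rest λ i →
                  subst (Disjoint (lookup xs i)) (sym (∨-assoc p x _)) (prefix (suc i)))
    where rest = independentAfter⇔prefixDisjoint (p ∨ x) xs

  latticeIndependent⇔independent : ∀ xs → LatticeIndependent xs ⇔ Independent xs
  latticeIndependent⇔independent xs = mk⇔
    (λ li → proj₂ (Equivalence.to (independentAfter⇔independent ⊥ xs)
                    (Equivalence.from (independentAfter⇔prefixDisjoint ⊥ xs) λ i →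
                      subst (Disjoint (lookup xs i)) (sym (identityˡ _)) (li i))))
    (λ ind i → subst (Disjoint (lookup xs i)) (identityˡ _)
                 (Equivalence.to (independentAfter⇔prefixDisjoint ⊥ xs)
                   (Equivalence.from (independentAfter⇔independent ⊥ xs)
                     (≤⊥⇒≡⊥ (x∧y≤x ⊥ (⋁ xs)) , ind)) i))

  reorderable⇔independent : ∀ xs → (∃[ ys ] (ys ↭ xs × LatticeIndependent ys)) ⇔ Independent xs
  reorderable⇔independent xs = mk⇔
    (λ (ys , ys↭xs , li) →
       independent-↭ ys↭xs (Equivalence.to (latticeIndependent⇔independent ys) li))
    (λ ind → xs , refl , Equivalence.from (latticeIndependent⇔independent xs) ind)

  independent⇒unique : ∀ {xs} → All (⊥ <_) xs → Independent xs → Unique xs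
  independent⇒unique []           _             = []
  independent⇒unique (⊥<x ∷ ⊥<xs) (x⊥xs , ind) =
    ¬Any⇒All¬ _ (⊥<⇒≢⊥ ⊥<x ∘ below-disjoint x⊥xs ≤-refl ∘ ∈⇒≤⋁) ∷
    independent⇒unique ⊥<xs ind

  essentialIn-⋁ : ∀ {y ds} → Independent ds → All IsQuasiAtom ds → All (_meets y) ds →
                  EssentialIn (⋁ (map (_∧ y) ds)) (⋁ ds)
  essentialIn-⋁ {ds = []} _ _ _ =
    ≤-refl , λ p ⊥<p p≤⊥ → ⊥-elim (⊥<⇒≢⊥ ⊥<p (≤⊥⇒≡⊥ p≤⊥))
  essentialIn-⋁ {ds = d ∷ ds} (d⊥ds , ind) (qd ∷ qds) (d-meets ∷ ds-meet) =
    essentialIn-∨ d⊥ds (quasiAtom-essentialIn qd d-meets) (essentialIn-⋁ ind qds ds-meet)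

  meets-⋁-transfer : ∀ {x y ds} → Independent ds → All IsQuasiAtom ds → All (_meets y) ds →
                     x meets ⋁ ds → x meets y
  meets-⋁-transfer {x} {y} {ds} ind qds ds-meet x-meets =
    meets-mono (proj₂ (essentialIn-⋁ ind qds ds-meet) (x ∧ ⋁ ds) x-meets (x∧y≤y x (⋁ ds)))
               (x∧y≤x x (⋁ ds)) (⋁-map-∧≤ y ds)

module QuasiAtomClosure {c ℓ} (L : ModularLatticeWithBottom c ℓ) (em : ExcludedMiddle (c ⊔ ℓ)) where
  open ModularLatticeWithBottom L
  open ModularLatticeFacts L

  Subset : Set _
  Subset = Pred Carrier (c ⊔ ℓ)

  disjoint-or-meets : ∀ x y → Disjoint x y ⊎ x meets y
  disjoint-or-meets x y with em {Lift ℓ (Disjoint x y)}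
  ... | yes (lift x⊥y) = inj₁ x⊥y
  ... | no ¬x⊥y        = inj₂ (≢⊥⇒⊥< (¬x⊥y ∘ lift))

  independent-spanning-sublist : ∀ xs → All IsQuasiAtom xs →
    ∃[ ds ] (Independent ds × All (_∈ xs) ds × All (_meets ⋁ ds) xs)
  independent-spanning-sublist []       _            = [] , _ , [] , []
  independent-spanning-sublist (x ∷ xs) (qx ∷ qxs)
    with independent-spanning-sublist xs qxs
  ... | ds , ind , ds⊆xs , xs-meet with disjoint-or-meets x (⋁ ds)
  ... | inj₁ x⊥ds    = x ∷ ds , (x⊥ds , ind) , here refl ∷ All.map there ds⊆xs ,
                       ⊥<⇒meets-above (proj₁ qx) (x≤x∨y x (⋁ ds)) ∷
                       All.map (λ y-meets → meets-mono y-meets ≤-refl (y≤x∨y x (⋁ ds))) xs-meet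
  ... | inj₂ x-meets = ds , ind , All.map there ds⊆xs , x-meets ∷ xs-meet

  -- The finitary form of: x lies in every V(y) that contains A.
  closure : Subset → Subset
  closure A x = IsQuasiAtom x × ∃[ bs ] (All A bs × (∀ y → All (_meets y) bs → x meets y))

  closure-of-⋁ : ∀ {A x ds} → Independent ds → All IsQuasiAtom ds → All A ds →
                 IsQuasiAtom x → x meets ⋁ ds → closure A x
  closure-of-⋁ {ds = ds} ind qds ads qx x-meets =
    qx , ds , ads , λ y ds-meet → meets-⋁-transfer ind qds ds-meet x-meets

  closure-mono : ∀ {A B} → A ⊆ B → closure A ⊆ closure B
  closure-mono A⊆B (qx , bs , abs , span) = qx , bs , All.map A⊆B abs , span

  closure-idempotent : ∀ A → closure (closure A) ⊆ closure A
  closure-idempotent A (qx , bs , cbs , span) =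
    let cs , acs , cs⇒bs = flatten bs cbs in qx , cs , acs , λ y → span y ∘ cs⇒bs y
    where
    flatten : ∀ bs → All (closure A) bs →
              ∃[ cs ] (All A cs × (∀ y → All (_meets y) cs → All (_meets y) bs))
    flatten []       []                                = [] , [] , λ _ _ → []
    flatten (b ∷ bs) ((_ , ws , aws , span-b) ∷ cbs) =
      let cs , acs , cs⇒bs = flatten bs cbs
      in  ws ++ cs , ++⁺ aws acs ,
          λ y meet → span-b y (++⁻ˡ ws meet) ∷ cs⇒bs y (++⁻ʳ ws meet)

  drop-point : ∀ {A : Subset} y cs → All (A ∪ sing (c ⊔ ℓ) y) cs →
               ∃[ bs ] (All A bs × All (_∈ y ∷ bs) cs)
  drop-point y []       []                   = [] , [] , []
  drop-point y (_ ∷ cs) (inj₁ a ∷ acs)       =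
    let bs , abs , cs⊆ = drop-point y cs acs
    in  _ ∷ bs , a ∷ abs , there (here refl) ∷ All.map (∷⁺ʳ y (xs⊆x∷xs bs _)) cs⊆
  drop-point y (_ ∷ cs) (inj₂ (lift refl) ∷ acs) =
    let bs , abs , cs⊆ = drop-point y cs acs in bs , abs , here refl ∷ cs⊆

  -- With ds an independent spanning part of A, x ∉ cl A forces x ⊥ ⋁ ds; then x meets
  -- ⋁ ds ∨ y, and modularity turns this around into y meets ⋁ ds ∨ x.
  closure-exchange : ∀ A → A ⊆ IsQuasiAtom → ∀ x y → IsQuasiAtom x → IsQuasiAtom y →
    closure (A ∪ sing (c ⊔ ℓ) y) x → ¬ closure A x → closure (A ∪ sing (c ⊔ ℓ) x) y
  closure-exchange A A⊆Q x y qx qy (_ , cs , acs , span) x∉clA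
    with drop-point y cs acs
  ... | bs , abs , cs⊆ with independent-spanning-sublist bs (All.map A⊆Q abs)
  ... | ds , ind , ds⊆bs , bs-meet =
    closure-of-⋁ (x⊥ds , ind) (qx ∷ qds) (inj₂ (lift refl) ∷ All.map inj₁ ads) qy
      (meets-mono (meets-exchange x⊥ds x-meets-ds∨y) ≤-refl (reflexive (∨-comm (⋁ ds) x)))
    where
    qbs = All.map A⊆Q abs
    qds = All.map (All.lookup qbs) ds⊆bs
    ads = All.map (All.lookup abs) ds⊆bs
    x⊥ds : Disjoint x (⋁ ds)
    x⊥ds with disjoint-or-meets x (⋁ ds)
    ... | inj₁ x⊥ds    = x⊥ds
    ... | inj₂ x-meets = ⊥-elim (x∉clA (closure-of-⋁ ind qds ads qx x-meets))
    w = ⋁ ds ∨ y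
    y∷bs-meet : All (_meets w) (y ∷ bs)
    y∷bs-meet = ⊥<⇒meets-above (proj₁ qy) (y≤x∨y (⋁ ds) y) ∷
      All.map (meets-⋁-transfer ind qds
                 (⊥<⇒meets-⋁-above (All.map proj₁ qds) (x≤x∨y (⋁ ds) y))) bs-meet
    x-meets-ds∨y : x meets ⋁ ds ∨ y
    x-meets-ds∨y = span w (All.map (All.lookup y∷bs-meet) cs⊆)

  closure-isPregeometry : IsFinitaryPregeometry IsQuasiAtom closure
  closure-isPregeometry = record
    { closure-in-Q = λ _ _ → proj₁
    ; extensive    = λ _ A⊆Q {x} x∈A →
                       A⊆Q x∈A , x ∷ [] , x∈A ∷ [] , λ { _ (x-meets ∷ []) → x-meets }
    ; monotone     = λ _ _ A⊆B _ → closure-mono A⊆B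
    ; idempotent   = λ A _ → closure-idempotent A
    ; finitary     = λ _ _ (qx , bs , abs , span) →
                       bs , abs , qx , bs , All.tabulate lift , span
    ; exchange     = closure-exchange
    }

  private module ClosureFacts = PregeometryFacts closure-isPregeometry

  closure-independentSet⇒independent : ∀ {xs} → All IsQuasiAtom xs → Unique xs →
    IndependentSet {q = ℓ} closure (listSet ℓ xs) → Independent xs
  closure-independentSet⇒independent {[]}     _          _              _      = _
  closure-independentSet⇒independent {x ∷ xs} qxs′@(qx ∷ qxs) (x≢xs ∷ uniq) indset
    with closure-independentSet⇒independent qxs uniq (ClosureFacts.independentSet-tail qxs′ indset)
  ... | ind with disjoint-or-meets x (⋁ xs)
  ... | inj₁ x⊥xs    = x⊥xs , ind
  ... | inj₂ x-meets = ⊥-elim (ClosureFacts.independentSet-∷⇒∉cl qxs′ (All¬⇒¬Any x≢xs)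
                         indset (closure-of-⋁ ind qxs (All.tabulate lift) qx x-meets))

  independent⇒closure-independentSet : ∀ {xs} → All IsQuasiAtom xs → Independent xs →
    IndependentSet {q = ℓ} closure (listSet ℓ xs)
  independent⇒closure-independentSet qxs ind z (lift z∈xs) (_ , cs , acs , span)
    with ∈⇒↭∷ z∈xs
  ... | rest , xs↭z∷rest =
    ⊥<⇒≢⊥ (span (⋁ rest) (All.map cs-meet acs)) (proj₁ (independent-↭ xs↭z∷rest ind))
    where
    cs-meet : ∀ {y} → minus ℓ (listSet ℓ _) z y → y meets ⋁ rest
    cs-meet (lift y∈xs , y≢z) with ∈-resp-↭ xs↭z∷rest y∈xs
    ... | here y≡z     = ⊥-elim (y≢z y≡z)
    ... | there y∈rest = ⊥<⇒meets-above (proj₁ (All.lookup qxs y∈xs)) (∈⇒≤⋁ y∈rest)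

  closure-characterization : IndependenceCharacterization L closure
  closure-characterization xs qxs uniq = ⇔-trans
    (mk⇔ (closure-independentSet⇒independent qxs uniq) (independent⇒closure-independentSet qxs))
    (⇔-sym (reorderable⇔independent xs))

  Spanned : Subset → Subset
  Spanned A x = IsQuasiAtom x × ∃[ ds ] (Independent ds × All A ds × x meets ⋁ ds)

  module Characterized (cl : Subset → Subset) (isPregeometry : IsFinitaryPregeometry IsQuasiAtom cl)
                       (characterization : IndependenceCharacterization L cl) where
    open IsFinitaryPregeometry isPregeometry
    open PregeometryFacts isPregeometry

    independentSet⇔independent : ∀ {xs} → All IsQuasiAtom xs → Unique xs →
      IndependentSet {q = ℓ} cl (listSet ℓ xs) ⇔ Independent xs
    independentSet⇔independent {xs} qxs uniq =
      ⇔-trans (characterization xs qxs uniq) (reorderable⇔independent xs)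

    cl-independent⇒meets : ∀ {x ds} → Independent ds → All IsQuasiAtom ds → IsQuasiAtom x →
                           cl (listSet ℓ ds) x → x meets ⋁ ds
    cl-independent⇒meets {x} {ds} ind qds qx x∈cl = ≢⊥⇒⊥< λ x⊥ds →
      let uniq = independent⇒unique (All.map proj₁ (qx ∷ qds)) (x⊥ds , ind)
      in  independentSet-∷⇒∉cl (qx ∷ qds) (All¬⇒¬Any (AllPairs.head uniq))
            (Equivalence.from (independentSet⇔independent (qx ∷ qds) uniq) (x⊥ds , ind)) x∈cl

    meets⇒cl-independent : ∀ {x ds} → Independent ds → All IsQuasiAtom ds → IsQuasiAtom x →
                           x meets ⋁ ds → cl (listSet ℓ ds) x
    meets⇒cl-independent {x} {ds} ind qds qx x-meets with em {cl (listSet ℓ ds) x}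
    ... | yes x∈cl = x∈cl
    ... | no x∉cl  = ⊥-elim (⊥<⇒≢⊥ x-meets (proj₁
          (Equivalence.to (independentSet⇔independent (qx ∷ qds) uniq)
            (independentSet-∷ (qx ∷ qds) ds-indset x∉cl))))
      where
      uniq-ds = independent⇒unique (All.map proj₁ qds) ind
      ds-indset = Equivalence.from (independentSet⇔independent qds uniq-ds) ind
      uniq : Unique (x ∷ ds)
      uniq = ¬Any⇒All¬ _ (x∉cl ∘ extensive _ (listSet⊆ qds) ∘ lift) ∷ uniq-ds

    cl≐spanned : ∀ A → A ⊆ IsQuasiAtom → cl A ≐ Spanned A
    cl≐spanned A A⊆Q = to , from
      where
      to : cl A ⊆ Spanned A
      to x∈clA with finitary A A⊆Q x∈clA
      ... | xs , axs , x∈clxs with independent-spanning-sublist xs (All.map A⊆Q axs)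
      ... | ds , ind , ds⊆xs , xs-meet =
        qx , ds , ind , All.map (All.lookup axs) ds⊆xs ,
        cl-independent⇒meets ind qds qx
          (idempotent _ (listSet⊆ qds)
            (monotone _ _ xs⊆cl-ds (closure-in-Q _ (listSet⊆ qds)) x∈clxs))
        where
        qx  = closure-in-Q A A⊆Q x∈clA
        qds = All.map (A⊆Q ∘ All.lookup axs) ds⊆xs
        xs⊆cl-ds : listSet ℓ xs ⊆ cl (listSet ℓ ds)
        xs⊆cl-ds (lift y∈xs) =
          meets⇒cl-independent ind qds (A⊆Q (All.lookup axs y∈xs)) (All.lookup xs-meet y∈xs)
      from : Spanned A ⊆ cl A
      from (qx , ds , ind , ads , x-meets) =
        monotone _ A (λ (lift d∈ds) → All.lookup ads d∈ds) A⊆Q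
          (meets⇒cl-independent ind (All.map A⊆Q ads) qx x-meets)

  open Characterized closure closure-isPregeometry closure-characterization
    using () renaming (cl≐spanned to closure≐spanned)

  characterized-closure-unique : ∀ cl → IsFinitaryPregeometry IsQuasiAtom cl →
    IndependenceCharacterization L cl → ∀ A → A ⊆ IsQuasiAtom → cl A ≐ closure A
  characterized-closure-unique cl isPregeometry characterization A A⊆Q =
    proj₂ (closure≐spanned A A⊆Q) ∘ proj₁ (cl≐spanned A A⊆Q) ,
    proj₂ (cl≐spanned A A⊆Q) ∘ proj₁ (closure≐spanned A A⊆Q)
    where open Characterized cl isPregeometry characterization

  V-closed : ∀ x → Closed {q = ℓ} closure (V L x)
  V-closed x (qa , bs , V-bs , span) = qa , span x (All.map proj₂ V-bs)

  closure-singleton : ∀ {a x} → IsQuasiAtom a → IsQuasiAtom x → closure (sing ℓ a) x ⇔ x meets a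
  closure-singleton {a} qa qx = mk⇔
    (λ (_ , bs , bs≡a , span) →
       span a (All.map (λ { (lift refl) → ⊥<⇒meets-above (proj₁ qa) ≤-refl }) bs≡a))
    (λ x-meets → qx , a ∷ [] , lift refl ∷ [] ,
       λ { _ (a-meets ∷ []) → meets-via-quasiAtom qa x-meets a-meets })

  closure-singleton-mono : ∀ {a b} → IsQuasiAtom a → IsQuasiAtom b → a meets b →
                           closure (sing ℓ a) ⊆ closure (sing ℓ b)
  closure-singleton-mono qa qb a-meets-b x∈cla@(qx , _) =
    Equivalence.from (closure-singleton qb qx)
      (meets-via-quasiAtom qa (Equivalence.to (closure-singleton qa qx) x∈cla) a-meets-b)

  parallel⇔meets : ∀ {a b} → IsQuasiAtom a → IsQuasiAtom b →
                   (closure (sing ℓ a) ≐ closure (sing ℓ b)) ⇔ a meets b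
  parallel⇔meets qa qb = mk⇔
    (λ (cla⊆clb , _) → Equivalence.to (closure-singleton qb qa) (cla⊆clb a∈cla))
    (λ a-meets-b → (λ {x} → closure-singleton-mono qa qb a-meets-b {x}) ,
                   (λ {x} → closure-singleton-mono qb qa (meets-sym a-meets-b) {x}))
    where
    a∈cla = Equivalence.from (closure-singleton qa qa) (⊥<⇒meets-above (proj₁ qa) ≤-refl)

  closure-∅ : ∀ {x} → ¬ closure (emptySet L) x
  closure-∅ {x} (_ , [] , [] , span) = ⊥<⇒≢⊥ (span ⊥ []) (≤⊥⇒≡⊥ (x∧y≤y x ⊥))
  closure-∅ (_ , _ ∷ _ , lift () ∷ _ , _)

corollary9p37 : ∀ {c ℓ} (L : ModularLatticeWithBottom c ℓ) → ExcludedMiddle (c ⊔ ℓ) →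
    let open ModularLatticeWithBottom L in
    Σ (Pred Carrier (c ⊔ ℓ) → Pred Carrier (c ⊔ ℓ)) (λ cl →
      -- (1) cl is a finitary pregeometry on Q with the stated independence
      IsFinitaryPregeometry IsQuasiAtom cl
      × IndependenceCharacterization L cl
      -- ... and it is characterized by this property
      × (∀ cl′ → IsFinitaryPregeometry IsQuasiAtom cl′ → IndependenceCharacterization L cl′ →
           ∀ A → A ⊆ IsQuasiAtom → cl′ A ≐ cl A)
      -- (2) every V(x) is closed
      × (∀ x → Closed {q = ℓ} cl (V L x))
      -- (3) quasi-atoms are parallel iff their meet is above bottom
      × (∀ a b → IsQuasiAtom a → IsQuasiAtom b →
           ((cl (sing ℓ a) ≐ cl (sing ℓ b)) ⇔ (⊥ < (a ∧ b))))
      -- no loops (so the parallel classes carry the induced geometry)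
      × (∀ a → IsQuasiAtom a → ¬ cl (emptySet L) a))
corollary9p37 L em =
  closure , closure-isPregeometry , closure-characterization , characterized-closure-unique ,
  V-closed , (λ _ _ → parallel⇔meets) , λ _ _ → closure-∅
  where open QuasiAtomClosure L em
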